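{- Let $G$ be a $2\cdot P_3$-free graph of order $n\geq 6$. Then $G\subseteq F_{n,1}(K_h)$ for some $4\leq h\leq 5$, or $G\subseteq F_{n,1}(N_6)$, or $G\subseteq F_{n,2}$.
   Context: All graphs are finite and simple. $P_3$ is the path on 3 vertices and $2\cdot P_3$ two disjoint copies; $G$ is $F$-free if it has no subgraph isomorphic to $F$, and $G\subseteq H$ means $G$ is isomorphic to a subgraph of $H$. $K_m$ is the complete graph on $m$ vertices ($K_0$ is empty), $\nabla$ the join, $p\cdot K_2$ a matching of $p$ edges. For a connected graph $H$ of order $h\ge 2$, an integer $k\ge1$ and $n>k+h-1$, $F_{n,k}(H)=K_{k-1}\nabla(H\cup p\cdot K_2\cup K_s)$ with $n-(k+h-1)=2p+s$, $0\leq s<2$ (so $F_{n,1}(H)=H\cup p\cdot K_2\cup K_s$); $F_{n,k}=F_{n,k}(K_2)$. $N_6$ is the 6-vertex graph obtained from a triangle by attaching a pendant edge to each of its vertices. -}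

module Defs where

open import Data.Nat using (ℕ; zero; suc; _∸_; _<ᵇ_; _≡ᵇ_; _/_)
open import Data.Fin using (Fin; toℕ) renaming (zero to fzero; suc to fsuc)
open import Data.Bool using (Bool; true; false; not; _∧_; _∨_; if_then_else_)
open import Data.Maybe using (Maybe; just; nothing)
import Data.Maybe as Maybe
open import Data.List using (List; []; _∷_)
open import Data.Bool.ListAction using (any)
open import Data.Product using (Σ; _×_; _,_)
open import Relation.Binary.PropositionalEquality using (_≡_)
open import Function.Definitions using (Injective)

Graph : ℕ → Set
Graph n = Fin n → Fin n → Bool

record IsSimple {n : ℕ} (G : Graph n) : Set where
  field
    sym     : ∀ i j → G i j ≡ G j i
    irrefl  : ∀ i → G i i ≡ false

_⊆_ : ∀ {n m} → Graph n → Graph m → Set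
_⊆_ {n} {m} G H =
  Σ (Fin n → Fin m) λ f →
    Injective _≡_ _≡_ f × (∀ i j → G i j ≡ true → H (f i) (f j) ≡ true)

fromEdges : ∀ {n} → List (ℕ × ℕ) → Graph n
fromEdges es i j =
  any (λ { (a , b) → ((a ≡ᵇ toℕ i) ∧ (b ≡ᵇ toℕ j)) ∨ ((a ≡ᵇ toℕ j) ∧ (b ≡ᵇ toℕ i)) }) es

K : (m : ℕ) → Graph m
K m i j = not (toℕ i ≡ᵇ toℕ j)

TwoP3 : Graph 6
TwoP3 = fromEdges ((0 , 1) ∷ (1 , 2) ∷ (3 , 4) ∷ (4 , 5) ∷ [])

-- N_6 : triangle 0,1,2 with pendant edges 0-3, 1-4, 2-5
N6 : Graph 6
N6 = fromEdges ((0 , 1) ∷ (1 , 2) ∷ (0 , 2) ∷ (0 , 3) ∷ (1 , 4) ∷ (2 , 5) ∷ [])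

toFin? : (h : ℕ) → ℕ → Maybe (Fin h)
toFin? zero    _       = nothing
toFin? (suc h) zero    = just fzero
toFin? (suc h) (suc a) = Maybe.map fsuc (toFin? h a)

-- F_{n,k}(H) = K_{k-1} ∇ (H ∪ p·K_2 ∪ K_s) on vertex set Fin n:
-- vertices 0..k-2 form K_{k-1} (joined to everything); the next h vertices
-- carry H; the remaining n-(k+h-1) = 2p+s vertices are paired consecutively
-- into p disjoint edges, with s ∈ {0,1} leftover isolated vertex.
F : (n k : ℕ) {h : ℕ} → Graph h → Graph n
F n k {h} H i j =
  if toℕ i ≡ᵇ toℕ j then false
  else if (toℕ i <ᵇ c) ∨ (toℕ j <ᵇ c) then true
  else rest (toFin? h a) (toFin? h b)
  where
    c = k ∸ 1
    a = toℕ i ∸ c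
    b = toℕ j ∸ c
    rest : Maybe (Fin h) → Maybe (Fin h) → Bool
    rest (just x) (just y) = H x y
    rest nothing  nothing  = ((a ∸ h) / 2) ≡ᵇ ((b ∸ h) / 2)
    rest _        _        = false

-- Call a vertex set S closed if it contains all neighbours of its vertices. If a closed S
-- contains a P3, then 2·P3-freeness leaves every vertex outside S with at most one neighbour,
-- so G is G[S] plus a matching and G ⊆ F n 1 H for any H receiving G[S]. A vertex x for which
-- G − x is a matching gives G ⊆ F n 2 K₂ instead. Split on the maximum degree Δ:
--   Δ ≥ 4: for x of degree ≥ 4, either G − x is a matching, or some P3 avoids x; then x is
--          adjacent to its ends, and x, the P3 and one more neighbour of x form a closed set
--          of five vertices;
--   Δ = 3: if N(x) = {a, b, c}, each of a, b, c has at most one neighbour outside N[x]; as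
--          these are 0, 1, 2 or 3 distinct vertices we get a closed K₄, K₅, N₆, or G − x is
--          a matching;
--   Δ = 2: the component of a vertex of degree 2 is a path or a cycle on at most 5 vertices;
--   Δ ≤ 1: G is a matching.
module Submission where

open import Defs
open import Data.Nat using (ℕ; zero; suc; _≤_; _<_; _/_; _≡ᵇ_; s≤s; z≤n)
open import Data.Nat.DivMod using (m/n≡1+[m∸n]/n)
open import Data.Nat.Properties using (≤-refl; n≤1+n; ≡ᵇ⇒≡)
open import Data.Fin using (Fin; toℕ; punchIn; punchOut; _≟_) renaming (suc to fsuc)
open import Data.Fin.Patterns using (0F; 1F; 2F; 3F; 4F; 5F; 6F)
open import Data.Fin.Properties
  using (toℕ-injective; suc-injective; punchIn-injective; punchInᵢ≢i; punchOut-cong; punchIn-punchOut; punchOut-punchIn; any?)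
open import Data.Bool using (true; false; T)
import Data.Bool as Bool
open import Data.Bool.Properties using (T-≡; T-∨; T-∧)
open import Data.Maybe using (just; nothing)
open import Data.List using (List; _∷_)
import Data.List.Relation.Unary.All as List
open import Data.Vec using (Vec; lookup; _∷_; [])
open import Data.Vec.Relation.Unary.All using (All; []; _∷_; all?)
open import Data.Vec.Relation.Unary.All.Properties using (lookup⁺)
open import Data.Vec.Relation.Unary.AllPairs using (allPairs?)
open import Data.Vec.Relation.Unary.Any as Any using (here; there)
open import Data.Vec.Relation.Unary.Any.Properties using (lookup-index)
open import Data.Vec.Relation.Unary.Unique.Propositional using (Unique; []; _∷_)
open import Data.Vec.Relation.Unary.Unique.Propositional.Properties using (lookup-injective; map⁺)
open import Data.Vec.Membership.Propositional using (_∈_; _∉_)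
open import Data.Vec.Membership.Propositional.Properties using (∈-lookup)
open import Data.Product using (Σ; ∃; ∃₂; _×_; _,_; proj₁; proj₂)
open import Data.Sum using (_⊎_; inj₁; inj₂)
open import Data.Empty using (⊥; ⊥-elim)
open import Function using (Equivalence)
open import Function.Definitions using (Injective)
open import Relation.Binary.PropositionalEquality
open import Relation.Nullary using (¬_; Dec; yes; no; ¬?)
open import Relation.Nullary.Decidable using (True; toWitness; map′; _×-dec_)

private
  variable
    n m h k : ℕ

infixl 6 _─_

_─_ : Graph (suc n) → Fin (suc n) → Graph n
(G ─ x) i j = G (punchIn x i) (punchIn x j)

─-isSimple : {G : Graph (suc n)} (x : Fin (suc n)) → IsSimple G → IsSimple (G ─ x)
─-isSimple x simple = record
  { sym    = λ i j → IsSimple.sym simple _ _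
  ; irrefl = λ i → IsSimple.irrefl simple _
  }

IsMatching : Graph n → Set
IsMatching G = ∀ {w p q} → G w p ≡ true → G w q ≡ true → p ≡ q

-- F n 1 of the empty graph: the vertices 2i and 2i+1 are paired.
matching : (n : ℕ) → Graph n
matching n = F n 1 {0} (λ ())

true≢false : true ≢ false
true≢false ()

vertex-split : (x y : Fin (suc n)) → y ≡ x ⊎ ∃ λ j → punchIn x j ≡ y
vertex-split x y with x ≟ y
... | yes x≡y = inj₁ (sym x≡y)
... | no x≢y  = inj₂ (punchOut x≢y , punchIn-punchOut x≢y)

module Extension {G : Graph (suc n)} {T : Graph (suc m)} (x : Fin (suc n)) (s : Fin (suc m))
                 (emb : (G ─ x) ⊆ (T ─ s)) where

  private
    f = proj₁ emb

  extend : Fin (suc n) → Fin (suc m)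
  extend y with x ≟ y
  ... | yes _  = s
  ... | no x≢y = punchIn s (f (punchOut x≢y))

  extend-x : extend x ≡ s
  extend-x with x ≟ x
  ... | yes _  = refl
  ... | no x≢x = ⊥-elim (x≢x refl)

  extend-punchIn : ∀ j → extend (punchIn x j) ≡ punchIn s (f j)
  extend-punchIn j with x ≟ punchIn x j
  ... | yes x≡ = ⊥-elim (punchInᵢ≢i x j (sym x≡))
  ... | no x≢  = cong (λ k → punchIn s (f k)) (trans (punchOut-cong x refl) (punchOut-punchIn x))

  extend-injective : Injective _≡_ _≡_ extend
  extend-injective {y₁} {y₂} eq with vertex-split x y₁ | vertex-split x y₂
  ... | inj₁ refl | inj₁ refl = refl
  ... | inj₁ refl | inj₂ (j , refl) =
    ⊥-elim (punchInᵢ≢i s (f j) (sym (trans (sym extend-x) (trans eq (extend-punchIn j)))))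
  ... | inj₂ (j , refl) | inj₁ refl =
    ⊥-elim (punchInᵢ≢i s (f j) (trans (sym (extend-punchIn j)) (trans eq extend-x)))
  ... | inj₂ (j , refl) | inj₂ (k , refl) =
    cong (punchIn x) (proj₁ (proj₂ emb)
      (punchIn-injective s _ _ (trans (sym (extend-punchIn j)) (trans eq (extend-punchIn k)))))

  extend-⊆ : G x x ≡ false →
    (∀ j → G x (punchIn x j) ≡ true → T s (punchIn s (f j)) ≡ true) →
    (∀ j → G (punchIn x j) x ≡ true → T (punchIn s (f j)) s ≡ true) →
    G ⊆ T
  extend-⊆ loopless out-edge in-edge = extend , extend-injective , edge
    where
    edge : ∀ y₁ y₂ → G y₁ y₂ ≡ true → T (extend y₁) (extend y₂) ≡ true
    edge y₁ y₂ e with vertex-split x y₁ | vertex-split x y₂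
    ... | inj₁ refl | inj₁ refl = ⊥-elim (true≢false (trans (sym e) loopless))
    ... | inj₁ refl | inj₂ (j , refl) rewrite extend-x | extend-punchIn j = out-edge j e
    ... | inj₂ (j , refl) | inj₁ refl rewrite extend-x | extend-punchIn j = in-edge j e
    ... | inj₂ (j , refl) | inj₂ (k , refl) rewrite extend-punchIn j | extend-punchIn k = proj₂ (proj₂ emb) j k e

⊆-respʳ : {G : Graph n} {T T′ : Graph m} → G ⊆ T → (∀ i j → T i j ≡ T′ i j) → G ⊆ T′
⊆-respʳ (f , f-injective , f-edges) T≗T′ = f , f-injective , λ i j e → trans (sym (T≗T′ (f i) (f j))) (f-edges i j e)

suc-suc-/2 : ∀ a → suc (suc a) / 2 ≡ suc (a / 2)
suc-suc-/2 a = m/n≡1+[m∸n]/n {suc (suc a)} {2} (s≤s (s≤s z≤n))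

matching-shift₂ : ∀ n (i j : Fin n) → matching (suc (suc n)) (fsuc (fsuc i)) (fsuc (fsuc j)) ≡ matching n i j
matching-shift₂ n i j with toℕ i ≡ᵇ toℕ j
... | true  = refl
... | false rewrite suc-suc-/2 (toℕ i) | suc-suc-/2 (toℕ j) = refl

⊆-matching-via-edge : {G : Graph (suc (suc n))} → IsSimple G → IsMatching G →
  ∀ {u w} → G u w ≡ true → (u≢w : u ≢ w) → (G ─ u ─ punchOut u≢w) ⊆ matching n →
  G ⊆ matching (suc (suc n))
⊆-matching-via-edge {n} {G} simple deg {u} {w} u~w u≢w emb =
  Outer.extend-⊆ (IsSimple.irrefl simple u) out-edge in-edge
  where
  w₁ = punchOut u≢w
  punchIn-w₁ : punchIn u w₁ ≡ w
  punchIn-w₁ = punchIn-punchOut u≢w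
  w-only-u : ∀ {y} → G w y ≡ true → y ≡ u
  w-only-u w~y = deg w~y (trans (IsSimple.sym simple w u) u~w)
  w₁-isolated : ∀ j → (G ─ u) w₁ (punchIn w₁ j) ≢ true
  w₁-isolated j e =
    punchInᵢ≢i u (punchIn w₁ j) (w-only-u (subst (λ z → G z (punchIn u (punchIn w₁ j)) ≡ true) punchIn-w₁ e))
  module Inner = Extension {G = G ─ u} {T = matching (suc (suc n)) ─ 0F} w₁ 0F
    (⊆-respʳ emb (λ i j → sym (matching-shift₂ n i j)))
  inner : (G ─ u) ⊆ (matching (suc (suc n)) ─ 0F)
  inner = Inner.extend-⊆ (IsSimple.irrefl simple _) (λ j e → ⊥-elim (w₁-isolated j e))
    (λ j e → ⊥-elim (w₁-isolated j (trans (IsSimple.sym (─-isSimple u simple) w₁ (punchIn w₁ j)) e)))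
  module Outer = Extension {G = G} {T = matching (suc (suc n))} u 0F inner
  to-1 : ∀ {j} → G u (punchIn u j) ≡ true → proj₁ inner j ≡ 0F
  to-1 {j} e =
    trans (cong Inner.extend (punchIn-injective u j w₁ (trans (deg e u~w) (sym punchIn-w₁)))) Inner.extend-x
  out-edge : ∀ j → G u (punchIn u j) ≡ true → matching _ 0F (fsuc (proj₁ inner j)) ≡ true
  out-edge j e rewrite to-1 e = refl
  in-edge : ∀ j → G (punchIn u j) u ≡ true → matching _ (fsuc (proj₁ inner j)) 0F ≡ true
  in-edge j e rewrite to-1 (trans (IsSimple.sym simple _ _) e) = refl

⊆-matching : ∀ n {G : Graph n} → IsSimple G → IsMatching G → G ⊆ matching n
⊆-matching n {G} simple deg with any? (λ u → any? (λ w → G u w Bool.≟ true))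
... | no edgeless = (λ i → i) , (λ eq → eq) , λ i j e → ⊥-elim (edgeless (i , j , e))
⊆-matching zero          simple deg | yes (() , _)
⊆-matching (suc zero)    simple deg | yes (0F , 0F , e) = ⊥-elim (true≢false (trans (sym e) (IsSimple.irrefl simple 0F)))
⊆-matching (suc (suc n)) {G} simple deg | yes (u , w , u~w) =
  ⊆-matching-via-edge simple deg u~w u≢w
    (⊆-matching n (─-isSimple w₁ (─-isSimple u simple))
      (λ e₁ e₂ → punchIn-injective w₁ _ _ (punchIn-injective u _ _ (deg e₁ e₂))))
  where
  u≢w : u ≢ w
  u≢w refl = true≢false (trans (sym u~w) (IsSimple.irrefl simple u))
  w₁ = punchOut u≢w

F₂-without-apex : ∀ n (i j : Fin n) → (F (suc n) 2 (K 2) ─ 0F) i j ≡ matching n i j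
F₂-without-apex n 0F              0F              = refl
F₂-without-apex n 0F              1F              = refl
F₂-without-apex n 0F              (fsuc (fsuc j)) rewrite suc-suc-/2 (toℕ j) = refl
F₂-without-apex n 1F              0F              = refl
F₂-without-apex n 1F              1F              = refl
F₂-without-apex n 1F              (fsuc (fsuc j)) rewrite suc-suc-/2 (toℕ j) = refl
F₂-without-apex n (fsuc (fsuc i)) 0F              rewrite suc-suc-/2 (toℕ i) = refl
F₂-without-apex n (fsuc (fsuc i)) 1F              rewrite suc-suc-/2 (toℕ i) = refl
F₂-without-apex n (fsuc (fsuc i)) (fsuc (fsuc j)) with toℕ i ≡ᵇ toℕ j
... | true  = refl
... | false rewrite suc-suc-/2 (toℕ i) | suc-suc-/2 (toℕ j) = refl

IsMatchingWithout : Graph n → Fin n → Set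
IsMatchingWithout G x =
  ∀ {w p q} → w ≢ x → p ≢ x → q ≢ x → G w p ≡ true → G w q ≡ true → p ≡ q

⊆-F₂ : {G : Graph n} → IsSimple G → (x : Fin n) → IsMatchingWithout G x → G ⊆ F n 2 (K 2)
⊆-F₂ {suc n} {G} simple x deg =
  Extension.extend-⊆ {G = G} {T = F (suc n) 2 (K 2)} x 0F emb (IsSimple.irrefl simple x) (λ _ _ → refl) (λ _ _ → refl)
  where
  emb : (G ─ x) ⊆ (F (suc n) 2 (K 2) ─ 0F)
  emb = ⊆-respʳ
    (⊆-matching n (─-isSimple x simple) λ e₁ e₂ → punchIn-injective x _ _
      (deg (punchInᵢ≢i x _) (punchInᵢ≢i x _) (punchInᵢ≢i x _) e₁ e₂))
    (λ i j → sym (F₂-without-apex n i j))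

record Core (G : Graph n) (H : Graph h) : Set where
  field
    embed            : Fin h → Fin n
    injective        : Injective _≡_ _≡_ embed
    edges            : ∀ a b → G (embed a) (embed b) ≡ true → H a b ≡ true
    closed           : ∀ a {y} → G (embed a) y ≡ true → ∃ λ b → embed b ≡ y
    outside-matching : ∀ {w p q} → (∀ a → embed a ≢ w) → G w p ≡ true → G w q ≡ true → p ≡ q

restrict : {G : Graph (suc n)} {H : Graph (suc h)} (c : Core G H) → Core (G ─ Core.embed c 0F) (H ─ 0F)
restrict {G = G} c = record
  { embed            = embed′
  ; injective        = embed′-injective
  ; edges            = λ a b e → edges (fsuc a) (fsuc b) (subst₂ (λ y z → G y z ≡ true) (punchIn-embed′ a) (punchIn-embed′ b) e)
  ; closed           = closed′
  ; outside-matching = λ {w} out e₁ e₂ → punchIn-injective x _ _ (outside-matching (outside w out) e₁ e₂)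
  }
  where
  open Core c
  x = embed 0F
  x≢embed-suc : ∀ a → x ≢ embed (fsuc a)
  x≢embed-suc a eq with injective eq
  ... | ()
  embed′ : Fin _ → Fin _
  embed′ a = punchOut (x≢embed-suc a)
  punchIn-embed′ : ∀ a → punchIn x (embed′ a) ≡ embed (fsuc a)
  punchIn-embed′ a = punchIn-punchOut (x≢embed-suc a)
  embed′-injective : Injective _≡_ _≡_ embed′
  embed′-injective {a} {b} eq =
    suc-injective (injective (trans (sym (punchIn-embed′ a)) (trans (cong (punchIn x) eq) (punchIn-embed′ b))))
  preimage : ∀ j → (∃ λ b → embed b ≡ punchIn x j) → ∃ λ b → embed′ b ≡ j
  preimage j (0F , eq)     = ⊥-elim (punchInᵢ≢i x j (sym eq))
  preimage j (fsuc b , eq) = b , punchIn-injective x _ _ (trans (punchIn-embed′ b) eq)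
  closed′ : ∀ a {y} → (G ─ x) (embed′ a) y ≡ true → ∃ λ b → embed′ b ≡ y
  closed′ a {y} e = preimage y (closed (fsuc a) (subst (λ z → G z (punchIn x y) ≡ true) (punchIn-embed′ a) e))
  outside : ∀ w → (∀ a → embed′ a ≢ w) → ∀ a → embed a ≢ punchIn x w
  outside w out 0F eq       = punchInᵢ≢i x w (sym eq)
  outside w out (fsuc a) eq = out a (punchIn-injective x _ _ (trans (punchIn-embed′ a) eq))

F₁-shift : ∀ n {h} (H : Graph (suc h)) (i j : Fin n) → (F (suc n) 1 H ─ 0F) i j ≡ F n 1 (H ─ 0F) i j
F₁-shift n {h} H i j with toℕ i ≡ᵇ toℕ j | toFin? h (toℕ i) | toFin? h (toℕ j)
... | true  | _      | _      = refl
... | false | just _ | just _ = refl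
... | false | just _ | nothing = refl
... | false | nothing | just _ = refl
... | false | nothing | nothing = refl

toFin?-toℕ : ∀ h (b : Fin h) → toFin? h (toℕ b) ≡ just b
toFin?-toℕ (suc h) 0F       = refl
toFin?-toℕ (suc h) (fsuc b) rewrite toFin?-toℕ h b = refl

F₁-0-suc : ∀ n {h} (H : Graph (suc h)) (k : Fin n) (b : Fin h) → toℕ k ≡ toℕ b → F (suc n) 1 H 0F (fsuc k) ≡ H 0F (fsuc b)
F₁-0-suc n {h} H k b eq rewrite eq | toFin?-toℕ h b = refl

F₁-suc-0 : ∀ n {h} (H : Graph (suc h)) (k : Fin n) (b : Fin h) → toℕ k ≡ toℕ b → F (suc n) 1 H (fsuc k) 0F ≡ H (fsuc b) 0F
F₁-suc-0 n {h} H k b eq rewrite eq | toFin?-toℕ h b = refl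

core-⊆-F₁ : {G : Graph n} {H : Graph h} → IsSimple G → (c : Core G H) →
  Σ (G ⊆ F n 1 H) λ emb → ∀ a → toℕ (proj₁ emb (Core.embed c a)) ≡ toℕ a
core-⊆-F₁ {n} {zero} simple c = ⊆-matching n simple (Core.outside-matching c (λ ())) , λ ()
core-⊆-F₁ {zero} {suc h} simple c with Core.embed c 0F
... | ()
core-⊆-F₁ {suc n} {suc h} {G} {H} simple c = Outer.extend-⊆ (IsSimple.irrefl simple x) out-edge in-edge , position
  where
  open Core c
  x = embed 0F
  c′ = restrict c
  open Core c′ using () renaming (embed to embed′)
  IH = core-⊆-F₁ (─-isSimple x simple) c′
  f′ = proj₁ (proj₁ IH)
  module Outer = Extension {G = G} {T = F (suc n) 1 H} x 0F
    (⊆-respʳ (proj₁ IH) λ i j → sym (F₁-shift n H i j))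
  neighbour : ∀ j → G x (punchIn x j) ≡ true → ∃ λ b → embed′ b ≡ j
  neighbour j e with closed 0F e
  ... | 0F , eq     = ⊥-elim (punchInᵢ≢i x j (sym eq))
  ... | fsuc b , eq = b , punchIn-injective x _ _ (trans (punchIn-punchOut _) eq)
  out-edge : ∀ j → G x (punchIn x j) ≡ true → F (suc n) 1 H 0F (fsuc (f′ j)) ≡ true
  out-edge j e with neighbour j e
  ... | b , refl = trans (F₁-0-suc n H (f′ (embed′ b)) b (proj₂ IH b))
                        (edges 0F (fsuc b) (subst (λ z → G x z ≡ true) (punchIn-punchOut _) e))
  in-edge : ∀ j → G (punchIn x j) x ≡ true → F (suc n) 1 H (fsuc (f′ j)) 0F ≡ true
  in-edge j e with neighbour j (trans (IsSimple.sym simple _ _) e)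
  ... | b , refl = trans (F₁-suc-0 n H (f′ (embed′ b)) b (proj₂ IH b))
                        (edges (fsuc b) 0F (subst (λ z → G z x ≡ true) (punchIn-punchOut _) e))
  position : ∀ a → toℕ (Outer.extend (embed a)) ≡ toℕ a
  position 0F       = cong toℕ Outer.extend-x
  position (fsuc a) = begin
    toℕ (Outer.extend (embed (fsuc a)))       ≡⟨ cong (λ y → toℕ (Outer.extend y)) (sym (punchIn-punchOut _)) ⟩
    toℕ (Outer.extend (punchIn x (embed′ a))) ≡⟨ cong toℕ (Outer.extend-punchIn (embed′ a)) ⟩
    suc (toℕ (f′ (embed′ a)))                 ≡⟨ cong suc (proj₂ IH a) ⟩
    suc (toℕ a)                               ∎
    where open ≡-Reasoning

MapsEdge : Graph n → (Fin m → Fin n) → ℕ × ℕ → Set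
MapsEdge G f (a , b) = ∀ {i j} → toℕ i ≡ a → toℕ j ≡ b → G (f i) (f j) ≡ true

fromEdges-⊆ : (es : List (ℕ × ℕ)) {G : Graph n} → (∀ i j → G i j ≡ G j i) →
  (f : Fin m → Fin n) → Injective _≡_ _≡_ f → List.All (MapsEdge G f) es → fromEdges es ⊆ G
fromEdges-⊆ es {G} G-sym f f-injective listed = f , f-injective , λ i j e → edge es listed i j (from T-≡ e)
  where
  open Equivalence
  edge : ∀ es → List.All (MapsEdge G f) es → ∀ i j → T (fromEdges es i j) → G (f i) (f j) ≡ true
  edge ((a , b) ∷ es) (ab List.∷ rest) i j t with to T-∨ t
  ... | inj₂ t′ = edge es rest i j t′
  ... | inj₁ t′ with to T-∨ t′
  ...   | inj₁ t″ = ab (sym (≡ᵇ⇒≡ _ _ (proj₁ (to T-∧ t″)))) (sym (≡ᵇ⇒≡ _ _ (proj₂ (to T-∧ t″))))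
  ...   | inj₂ t″ = trans (G-sym (f i) (f j)) (ab (sym (≡ᵇ⇒≡ _ _ (proj₁ (to T-∧ t″)))) (sym (≡ᵇ⇒≡ _ _ (proj₂ (to T-∧ t″)))))

unique? : (is : Vec (Fin n) k) → Dec (Unique is)
unique? = allPairs? (λ i j → ¬? (i ≟ j))

∉⇒All≢ : {u : Fin n} {S : Vec (Fin n) k} → u ∉ S → All (u ≢_) S
∉⇒All≢ {S = []}    u∉ = []
∉⇒All≢ {S = _ ∷ S} u∉ = (λ eq → u∉ (here eq)) ∷ ∉⇒All≢ (λ u∈ → u∉ (there u∈))

∈∉⇒≢ : {u v : Fin n} {S : Vec (Fin n) k} → u ∈ S → v ∉ S → u ≢ v
∈∉⇒≢ u∈ v∉ refl = v∉ u∈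

∉⇒≢ : {S : Vec (Fin n) k} {u : Fin n} → u ∉ S → ∀ i → u ≢ lookup S i
∉⇒≢ {S = S} u∉ i eq = u∉ (subst (_∈ S) (sym eq) (∈-lookup i S))

∉-∷ : {S : Vec (Fin n) k} {u : Fin n} → u ∉ S → Unique S → Unique (u ∷ S)
∉-∷ u∉ distinct = ∉⇒All≢ u∉ ∷ distinct

outside⇒∉ : {S : Vec (Fin n) k} {w : Fin n} → (∀ i → lookup S i ≢ w) → w ∉ S
outside⇒∉ out w∈ = out (Any.index w∈) (sym (lookup-index w∈))

neither : ∀ {A : Set} {u a b : A} → u ≡ a ⊎ u ≡ b → u ≢ a → u ≢ b → ⊥
neither (inj₁ u≡a) u≢a _   = u≢a u≡a
neither (inj₂ u≡b) _   u≢b = u≢b u≡b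

the-other : ∀ {A : Set} {u a b : A} → u ≡ a ⊎ u ≡ b → u ≢ a → u ≡ b
the-other (inj₁ u≡a) u≢a = ⊥-elim (u≢a u≡a)
the-other (inj₂ u≡b) _   = u≡b

∃-∉ : ∀ {m} (v : Fin m → Fin n) → Injective _≡_ _≡_ v → (X : Vec (Fin n) k) → k < m → ∃ λ i → v i ∉ X
∃-∉ v v-injective [] (s≤s _) = 0F , λ ()
∃-∉ {m = suc m} v v-injective (x ∷ X) (s≤s k<m) with any? (λ i → v i ≟ x)
... | yes (i , vi≡x) with ∃-∉ (λ j → v (punchIn i j)) (λ eq → punchIn-injective i _ _ (v-injective eq)) X k<m
...   | j , vj∉X = punchIn i j , λ
        { (here eq)  → punchInᵢ≢i i j (sym (v-injective (trans vi≡x (sym eq))))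
        ; (there vj∈X) → vj∉X vj∈X }
∃-∉ {m = suc m} v v-injective (x ∷ X) (s≤s k<m) | no ∄ with ∃-∉ (λ j → v (fsuc j)) (λ eq → suc-injective (v-injective eq)) X k<m
...   | j , vj∉X = fsuc j , λ
        { (here eq)  → ∄ (fsuc j , eq)
        ; (there vj∈X) → vj∉X vj∈X }

∃-vec? : ∀ k {P : Vec (Fin n) k → Set} → (∀ V → Dec (P V)) → Dec (∃ P)
∃-vec? zero    P? = map′ ([] ,_) (λ { ([] , p) → p }) (P? [])
∃-vec? (suc k) P? = map′ (λ (x , V , p) → x ∷ V , p) (λ { (x ∷ V , p) → x , V , p })
  (any? λ x → ∃-vec? k λ V → P? (x ∷ V))

Conclusion : Graph n → Set
Conclusion {n} G = (Σ ℕ λ h → 4 ≤ h × h ≤ 5 × G ⊆ F n 1 (K h)) ⊎ (G ⊆ F n 1 N6) ⊎ (G ⊆ F n 2 (K 2))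

module FreeOf2P3 {G : Graph n} (simple : IsSimple G) (free : ¬ (TwoP3 ⊆ G)) where

  infix 4 _~_
  _~_ : Fin n → Fin n → Set
  a ~ b = G a b ≡ true

  _~?_ : ∀ a b → Dec (a ~ b)
  a ~? b = G a b Bool.≟ true

  ~-sym : ∀ {a b} → a ~ b → b ~ a
  ~-sym {a} {b} e = trans (IsSimple.sym simple b a) e

  ~⇒≢ : ∀ {a b} → a ~ b → a ≢ b
  ~⇒≢ {a} e refl = true≢false (trans (sym e) (IsSimple.irrefl simple a))

  disjoint-P3s : ∀ {a b c d e f} → Unique (a ∷ b ∷ c ∷ d ∷ e ∷ f ∷ []) → a ~ b → b ~ c → d ~ e → e ~ f → ⊥
  disjoint-P3s {a} {b} {c} {d} {e} {f} distinct ab bc de ef =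
    free (fromEdges-⊆ _ (IsSimple.sym simple) (lookup V) (λ {i} {j} → lookup-injective distinct i j)
      (edge 0F 1F ab List.∷ edge 1F 2F bc List.∷ edge 3F 4F de List.∷ edge 4F 5F ef List.∷ List.[]))
    where
    V = a ∷ b ∷ c ∷ d ∷ e ∷ f ∷ []
    edge : (i₀ j₀ : Fin 6) → lookup V i₀ ~ lookup V j₀ →
      ∀ {i j} → toℕ i ≡ toℕ i₀ → toℕ j ≡ toℕ j₀ → lookup V i ~ lookup V j
    edge i₀ j₀ e i≡ j≡ rewrite toℕ-injective i≡ | toℕ-injective j≡ = e

  disjoint-P3s-in : {S : Vec (Fin n) k} → Unique S → (i₁ i₂ i₃ j₁ j₂ j₃ : Fin k) →
    {True (unique? (i₁ ∷ i₂ ∷ i₃ ∷ j₁ ∷ j₂ ∷ j₃ ∷ []))} →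
    lookup S i₁ ~ lookup S i₂ → lookup S i₂ ~ lookup S i₃ →
    lookup S j₁ ~ lookup S j₂ → lookup S j₂ ~ lookup S j₃ → ⊥
  disjoint-P3s-in distinct i₁ i₂ i₃ j₁ j₂ j₃ {indices-distinct} =
    disjoint-P3s (map⁺ (λ {i} {j} → lookup-injective distinct i j) (toWitness indices-distinct))

  Closed : Vec (Fin n) k → Set
  Closed S = ∀ i {u} → lookup S i ~ u → u ∈ S

  closed-by-contradiction : {S : Vec (Fin n) k} → (∀ i {u} → lookup S i ~ u → u ∉ S → ⊥) → Closed S
  closed-by-contradiction {S = S} escape i {u} e with Any.any? (u ≟_) S
  ... | yes u∈ = u∈
  ... | no u∉  = ⊥-elim (escape i e u∉)

  ∈-closed : {S : Vec (Fin n) k} → Closed S → ∀ {u v} → u ∈ S → u ~ v → v ∈ S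
  ∈-closed closed u∈ e = closed (Any.index u∈) (subst (_~ _) (lookup-index u∈) e)

  IsP3Centre : Fin n → Set
  IsP3Centre s = ∃₂ λ a c → s ~ a × s ~ c × a ≢ c

  -- A P3 centred outside a closed S lies outside S, so it misses any P3 centred in S.
  outside-matching : {S : Vec (Fin n) k} → Closed S → ∀ i → IsP3Centre (lookup S i) →
    ∀ {w p q} → w ∉ S → w ~ p → w ~ q → p ≡ q
  outside-matching {S = S} closed i (a , c , sa , sc , a≢c) {w} {p} {q} w∉ wp wq with p ≟ q
  ... | yes p≡q = p≡q
  ... | no p≢q  = ⊥-elim (disjoint-P3s distinct (~-sym sa) sc (~-sym wp) wq)
    where
    s = lookup S i
    s∈ = ∈-lookup i S
    a∈ = ∈-closed closed s∈ sa
    c∈ = ∈-closed closed s∈ sc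
    p∉ : p ∉ S
    p∉ p∈ = w∉ (∈-closed closed p∈ (~-sym wp))
    q∉ : q ∉ S
    q∉ q∈ = w∉ (∈-closed closed q∈ (~-sym wq))
    distinct : Unique (a ∷ s ∷ c ∷ p ∷ w ∷ q ∷ [])
    distinct =
        (~⇒≢ (~-sym sa) ∷ a≢c ∷ ∈∉⇒≢ a∈ p∉ ∷ ∈∉⇒≢ a∈ w∉ ∷ ∈∉⇒≢ a∈ q∉ ∷ [])
      ∷ (~⇒≢ sc ∷ ∈∉⇒≢ s∈ p∉ ∷ ∈∉⇒≢ s∈ w∉ ∷ ∈∉⇒≢ s∈ q∉ ∷ [])
      ∷ (∈∉⇒≢ c∈ p∉ ∷ ∈∉⇒≢ c∈ w∉ ∷ ∈∉⇒≢ c∈ q∉ ∷ [])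
      ∷ (~⇒≢ (~-sym wp) ∷ p≢q ∷ [])
      ∷ (~⇒≢ wq ∷ [])
      ∷ [] ∷ []

  core : {H : Graph k} (S : Vec (Fin n) k) → Unique S → Closed S →
    (∀ a b → lookup S a ~ lookup S b → H a b ≡ true) → ∀ i → IsP3Centre (lookup S i) → Core G H
  core S distinct closed edges i centre = record
    { embed            = lookup S
    ; injective        = λ {a} {b} → lookup-injective distinct a b
    ; edges            = edges
    ; closed           = λ a e → let u∈ = closed a e in Any.index u∈ , sym (lookup-index u∈)
    ; outside-matching = λ out → outside-matching closed i centre (outside⇒∉ out)
    }

  matching-without : {S : Vec (Fin n) k} → Closed S → ∀ i → IsP3Centre (lookup S i) → (x : Fin n) →
    (∀ j {p q} → lookup S j ≢ x → lookup S j ~ p → lookup S j ~ q → p ≢ x → q ≢ x → p ≡ q) →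
    IsMatchingWithout G x
  matching-without {S = S} closed i centre x inside {w} w≢x p≢x q≢x wp wq with Any.any? (w ≟_) S
  ... | yes w∈ rewrite lookup-index w∈ = inside (Any.index w∈) w≢x wp wq p≢x q≢x
  ... | no w∉  = outside-matching closed i centre w∉ wp wq

  MaxDegree< : ℕ → Set
  MaxDegree< k = ∀ {v} {N : Vec (Fin n) k} → Unique N → All (v ~_) N → ⊥

  maxDegree<-or-witness : ∀ k → MaxDegree< k ⊎ ∃₂ λ v (N : Vec (Fin n) k) → Unique N × All (v ~_) N
  maxDegree<-or-witness k with any? (λ v → ∃-vec? k λ N → unique? N ×-dec all? (v ~?_) N)
  ... | yes (v , N , witness) = inj₂ (v , N , witness)
  ... | no none = inj₁ λ {v} {N} distinct adjacent → none (v , N , distinct , adjacent)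

  K-edges : (S : Vec (Fin n) k) → ∀ a b → lookup S a ~ lookup S b → K k a b ≡ true
  K-edges S a b e with toℕ a ≡ᵇ toℕ b in eq
  ... | false = refl
  ... | true  = ⊥-elim (~⇒≢ e (cong (lookup S) (toℕ-injective (≡ᵇ⇒≡ _ _ (Equivalence.from T-≡ eq)))))

  closed-core-⊆-F₁ : {H : Graph k} (S : Vec (Fin n) k) → Unique S → Closed S →
    (∀ a b → lookup S a ~ lookup S b → H a b ≡ true) → ∀ i → IsP3Centre (lookup S i) → G ⊆ F n 1 H
  closed-core-⊆-F₁ S distinct closed edges i centre = proj₁ (core-⊆-F₁ simple (core S distinct closed edges i centre))

  conclude-K : 4 ≤ k → k ≤ 5 → (S : Vec (Fin n) k) → Unique S → Closed S →
    ∀ i → IsP3Centre (lookup S i) → Conclusion G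
  conclude-K {k} 4≤k k≤5 S distinct closed i centre =
    inj₁ (k , 4≤k , k≤5 , closed-core-⊆-F₁ S distinct closed (K-edges S) i centre)

  conclude-K₄ : (S : Vec (Fin n) 4) → Unique S → Closed S → ∀ i → IsP3Centre (lookup S i) → Conclusion G
  conclude-K₄ = conclude-K ≤-refl (n≤1+n 4)

  conclude-K₅ : (S : Vec (Fin n) 5) → Unique S → Closed S → ∀ i → IsP3Centre (lookup S i) → Conclusion G
  conclude-K₅ = conclude-K (n≤1+n 4) ≤-refl

  conclude-N₆ : (S : Vec (Fin n) 6) → Unique S → Closed S → (∀ a b → lookup S a ~ lookup S b → N6 a b ≡ true) →
    ∀ i → IsP3Centre (lookup S i) → Conclusion G
  conclude-N₆ S distinct closed edges i centre =
    inj₂ (inj₁ (closed-core-⊆-F₁ S distinct closed edges i centre))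

  conclude-F₂ : (x : Fin n) → IsMatchingWithout G x → Conclusion G
  conclude-F₂ x matching = inj₂ (inj₂ (⊆-F₂ simple x matching))

  other-neighbour? : ∀ v w → Dec (∃ λ u → v ~ u × u ≢ w)
  other-neighbour? v w = any? (λ u → (v ~? u) ×-dec ¬? (u ≟ w))

  module MaxDegreeTwo (Δ<3 : MaxDegree< 3) where

    neighbours-among : ∀ {v a b u} → v ~ a → v ~ b → a ≢ b → v ~ u → u ≡ a ⊎ u ≡ b
    neighbours-among {a = a} {b} {u} va vb a≢b vu with u ≟ a | u ≟ b
    ... | yes u≡a | _       = inj₁ u≡a
    ... | no _    | yes u≡b = inj₂ u≡b
    ... | no u≢a  | no u≢b  = ⊥-elim (Δ<3 ((a≢b ∷ ≢-sym u≢a ∷ []) ∷ (≢-sym u≢b ∷ []) ∷ [] ∷ []) (va ∷ vb ∷ vu ∷ []))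

    triple-component : ∀ {x y z} → x ~ y → x ~ z → y ≢ z →
      (∀ {u} → y ~ u → u ≢ x → u ≡ z) → (∀ {u} → z ~ u → u ≢ x → u ≡ y) → Conclusion G
    triple-component {x} {y} {z} xy xz y≢z y-nbr z-nbr =
      conclude-F₂ x (matching-without (closed-by-contradiction escape) 0F (y , z , xy , xz , y≢z) x inside)
      where
      S = x ∷ y ∷ z ∷ []
      escape : ∀ i {u} → lookup S i ~ u → u ∉ S → ⊥
      escape 0F e u∉ = neither (neighbours-among xy xz y≢z e) (∉⇒≢ u∉ 1F) (∉⇒≢ u∉ 2F)
      escape 1F e u∉ = ∉⇒≢ u∉ 2F (y-nbr e (∉⇒≢ u∉ 0F))
      escape 2F e u∉ = ∉⇒≢ u∉ 1F (z-nbr e (∉⇒≢ u∉ 0F))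
      inside : ∀ j {p q} → lookup S j ≢ x → lookup S j ~ p → lookup S j ~ q → p ≢ x → q ≢ x → p ≡ q
      inside 0F x≢x _  _  _   _   = ⊥-elim (x≢x refl)
      inside 1F _   yp yq p≢x q≢x = trans (y-nbr yp p≢x) (sym (y-nbr yq q≢x))
      inside 2F _   zp zq p≢x q≢x = trans (z-nbr zp p≢x) (sym (z-nbr zq q≢x))

    leaf-path₅ : ∀ {x y z y′ y″} → x ~ y → x ~ z → y ≢ z → ¬ y ~ z → y ~ y′ → y′ ≢ x →
      (∀ {u} → z ~ u → u ≢ x → ⊥) → y′ ~ y″ → y″ ≢ y → Conclusion G
    leaf-path₅ {x} {y} {z} {y′} {y″} xy xz y≢z y≁z yy′ y′≢x z-leaf y′y″ y″≢y = go (other-neighbour? y″ y′)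
      where
      S = x ∷ y ∷ z ∷ y′ ∷ y″ ∷ []
      z≢y′ : z ≢ y′
      z≢y′ refl = y≁z yy′
      y″≢x : y″ ≢ x
      y″≢x refl = neither (neighbours-among xy xz y≢z (~-sym y′y″)) (≢-sym (~⇒≢ yy′)) (≢-sym z≢y′)
      y″≢z : y″ ≢ z
      y″≢z refl = z-leaf (~-sym y′y″) y′≢x
      distinct : Unique S
      distinct = (~⇒≢ xy ∷ ~⇒≢ xz ∷ ≢-sym y′≢x ∷ ≢-sym y″≢x ∷ [])
               ∷ (y≢z ∷ ~⇒≢ yy′ ∷ ≢-sym y″≢y ∷ [])
               ∷ (z≢y′ ∷ ≢-sym y″≢z ∷ [])
               ∷ (~⇒≢ y′y″ ∷ [])
               ∷ [] ∷ []
      go : Dec (∃ λ u → y″ ~ u × u ≢ y′) → Conclusion G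
      go (yes (u , y″u , u≢y′)) =
        ⊥-elim (disjoint-P3s-in (u≢S ∷ distinct) 0F 5F 4F 2F 1F 3F (~-sym y″u) (~-sym y′y″) (~-sym xy) xz)
        where
        u≢S : All (u ≢_) S
        u≢S = (λ { refl → neither (neighbours-among xy xz y≢z (~-sym y″u)) y″≢y y″≢z })
            ∷ (λ { refl → neither (neighbours-among (~-sym xy) yy′ (≢-sym y′≢x) (~-sym y″u)) y″≢x (≢-sym (~⇒≢ y′y″)) })
            ∷ (λ { refl → z-leaf (~-sym y″u) y″≢x })
            ∷ u≢y′
            ∷ ≢-sym (~⇒≢ y″u)
            ∷ []
      go (no y″-leaf) = conclude-K₅ S distinct (closed-by-contradiction escape) 0F (y , z , xy , xz , y≢z)
        where
        escape : ∀ i {u} → lookup S i ~ u → u ∉ S → ⊥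
        escape 0F e u∉ = neither (neighbours-among xy xz y≢z e) (∉⇒≢ u∉ 1F) (∉⇒≢ u∉ 2F)
        escape 1F e u∉ = neither (neighbours-among (~-sym xy) yy′ (≢-sym y′≢x) e) (∉⇒≢ u∉ 0F) (∉⇒≢ u∉ 3F)
        escape 2F e u∉ = z-leaf e (∉⇒≢ u∉ 0F)
        escape 3F e u∉ = neither (neighbours-among (~-sym yy′) y′y″ (≢-sym y″≢y) e) (∉⇒≢ u∉ 1F) (∉⇒≢ u∉ 4F)
        escape 4F e u∉ = y″-leaf (_ , e , ∉⇒≢ u∉ 3F)

    leaf-path : ∀ {x y z y′} → x ~ y → x ~ z → y ≢ z → ¬ y ~ z → y ~ y′ → y′ ≢ x →
      (∀ {u} → z ~ u → u ≢ x → ⊥) → Conclusion G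
    leaf-path {x} {y} {z} {y′} xy xz y≢z y≁z yy′ y′≢x z-leaf with other-neighbour? y′ y
    ... | yes (y″ , y′y″ , y″≢y) = leaf-path₅ xy xz y≢z y≁z yy′ y′≢x z-leaf y′y″ y″≢y
    ... | no y′-leaf = conclude-K₄ S distinct (closed-by-contradiction escape) 0F (y , z , xy , xz , y≢z)
      where
      S = x ∷ y ∷ z ∷ y′ ∷ []
      z≢y′ : z ≢ y′
      z≢y′ refl = y≁z yy′
      distinct : Unique S
      distinct = (~⇒≢ xy ∷ ~⇒≢ xz ∷ ≢-sym y′≢x ∷ []) ∷ (y≢z ∷ ~⇒≢ yy′ ∷ []) ∷ (z≢y′ ∷ []) ∷ [] ∷ []
      escape : ∀ i {u} → lookup S i ~ u → u ∉ S → ⊥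
      escape 0F e u∉ = neither (neighbours-among xy xz y≢z e) (∉⇒≢ u∉ 1F) (∉⇒≢ u∉ 2F)
      escape 1F e u∉ = neither (neighbours-among (~-sym xy) yy′ (≢-sym y′≢x) e) (∉⇒≢ u∉ 0F) (∉⇒≢ u∉ 3F)
      escape 2F e u∉ = z-leaf e (∉⇒≢ u∉ 0F)
      escape 3F e u∉ = y′-leaf (_ , e , ∉⇒≢ u∉ 1F)

    both-sides-extend : ∀ {x y z y′ z′} → x ~ y → x ~ z → y ≢ z → ¬ y ~ z →
      y ~ y′ → y′ ≢ x → z ~ z′ → z′ ≢ x → Conclusion G
    both-sides-extend {x} {y} {z} {y′} {z′} xy xz y≢z y≁z yy′ y′≢x zz′ z′≢x with y′ ≟ z′
    ... | yes refl = conclude-K₄ S distinct (closed-by-contradiction escape) 0F (y , z , xy , xz , y≢z)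
      where
      S = x ∷ y ∷ z ∷ y′ ∷ []
      distinct : Unique S
      distinct = (~⇒≢ xy ∷ ~⇒≢ xz ∷ ≢-sym y′≢x ∷ []) ∷ (y≢z ∷ ~⇒≢ yy′ ∷ []) ∷ (~⇒≢ zz′ ∷ []) ∷ [] ∷ []
      escape : ∀ i {u} → lookup S i ~ u → u ∉ S → ⊥
      escape 0F e u∉ = neither (neighbours-among xy xz y≢z e) (∉⇒≢ u∉ 1F) (∉⇒≢ u∉ 2F)
      escape 1F e u∉ = neither (neighbours-among (~-sym xy) yy′ (≢-sym y′≢x) e) (∉⇒≢ u∉ 0F) (∉⇒≢ u∉ 3F)
      escape 2F e u∉ = neither (neighbours-among (~-sym xz) zz′ (≢-sym y′≢x) e) (∉⇒≢ u∉ 0F) (∉⇒≢ u∉ 3F)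
      escape 3F e u∉ = neither (neighbours-among (~-sym yy′) (~-sym zz′) y≢z e) (∉⇒≢ u∉ 1F) (∉⇒≢ u∉ 2F)
    ... | no y′≢z′ = conclude-K₅ S distinct (closed-by-contradiction escape) 0F (y , z , xy , xz , y≢z)
      where
      S = x ∷ y ∷ z ∷ y′ ∷ z′ ∷ []
      z≢y′ : z ≢ y′
      z≢y′ refl = y≁z yy′
      y≢z′ : y ≢ z′
      y≢z′ refl = y≁z (~-sym zz′)
      distinct : Unique S
      distinct = (~⇒≢ xy ∷ ~⇒≢ xz ∷ ≢-sym y′≢x ∷ ≢-sym z′≢x ∷ [])
               ∷ (y≢z ∷ ~⇒≢ yy′ ∷ y≢z′ ∷ [])
               ∷ (z≢y′ ∷ ~⇒≢ zz′ ∷ [])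
               ∷ (y′≢z′ ∷ [])
               ∷ [] ∷ []
      escape : ∀ i {u} → lookup S i ~ u → u ∉ S → ⊥
      escape 0F e u∉ = neither (neighbours-among xy xz y≢z e) (∉⇒≢ u∉ 1F) (∉⇒≢ u∉ 2F)
      escape 1F e u∉ = neither (neighbours-among (~-sym xy) yy′ (≢-sym y′≢x) e) (∉⇒≢ u∉ 0F) (∉⇒≢ u∉ 3F)
      escape 2F e u∉ = neither (neighbours-among (~-sym xz) zz′ (≢-sym z′≢x) e) (∉⇒≢ u∉ 0F) (∉⇒≢ u∉ 4F)
      escape 3F e u∉ = disjoint-P3s-in (∉-∷ u∉ distinct) 0F 4F 2F 1F 3F 5F (~-sym e) (~-sym yy′) xz zz′
      escape 4F e u∉ = disjoint-P3s-in (∉-∷ u∉ distinct) 0F 5F 3F 1F 2F 4F (~-sym e) (~-sym zz′) xy yy′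

    conclusion : ∀ {x y z} → x ~ y → x ~ z → y ≢ z → Conclusion G
    conclusion {x} {y} {z} xy xz y≢z with y ~? z
    ... | yes yz = triple-component xy xz y≢z
        (λ e u≢x → the-other (neighbours-among (~-sym xy) yz (~⇒≢ xz) e) u≢x)
        (λ e u≢x → the-other (neighbours-among (~-sym xz) (~-sym yz) (~⇒≢ xy) e) u≢x)
    ... | no y≁z with other-neighbour? y x | other-neighbour? z x
    ...   | no y-leaf | no z-leaf =
            triple-component xy xz y≢z (λ e u≢x → ⊥-elim (y-leaf (_ , e , u≢x))) (λ e u≢x → ⊥-elim (z-leaf (_ , e , u≢x)))
    ...   | yes (y′ , yy′ , y′≢x) | no z-leaf =
            leaf-path xy xz y≢z y≁z yy′ y′≢x (λ e u≢x → z-leaf (_ , e , u≢x))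
    ...   | no y-leaf | yes (z′ , zz′ , z′≢x) =
            leaf-path xz xy (≢-sym y≢z) (λ zy → y≁z (~-sym zy)) zz′ z′≢x (λ e u≢x → y-leaf (_ , e , u≢x))
    ...   | yes (y′ , yy′ , y′≢x) | yes (z′ , zz′ , z′≢x) = both-sides-extend xy xz y≢z y≁z yy′ y′≢x zz′ z′≢x

  p3-avoiding? : ∀ x → Dec (∃₂ λ w p → ∃ λ q → w ≢ x × p ≢ x × q ≢ x × w ~ p × w ~ q × p ≢ q)
  p3-avoiding? x = any? λ w → any? λ p → any? λ q →
    ¬? (w ≟ x) ×-dec ¬? (p ≟ x) ×-dec ¬? (q ≟ x) ×-dec (w ~? p) ×-dec (w ~? q) ×-dec ¬? (p ≟ q)

  module FourNeighbours {x} (N : Vec (Fin n) 4) (N-distinct : Unique N) (x~N : All (x ~_) N) where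

    N-injective : Injective _≡_ _≡_ (lookup N)
    N-injective {i} {j} = lookup-injective N-distinct i j

    two-neighbours-outside : ∀ {t} (o₁ o₂ : Fin n) → ¬ x ~ t →
      ∃₂ λ n₁ n₂ → x ~ n₁ × x ~ n₂ × n₁ ≢ n₂ × n₁ ∉ (t ∷ o₁ ∷ o₂ ∷ []) × n₂ ∉ (t ∷ o₁ ∷ o₂ ∷ [])
    two-neighbours-outside {t} o₁ o₂ x≁t with ∃-∉ (lookup N) N-injective (o₁ ∷ o₂ ∷ []) (s≤s (s≤s (s≤s z≤n)))
    ... | i , Ni∉ with ∃-∉ (lookup N) N-injective (lookup N i ∷ o₁ ∷ o₂ ∷ []) (s≤s (s≤s (s≤s (s≤s z≤n))))
    ...   | j , Nj∉ = lookup N i , lookup N j , lookup⁺ x~N i , lookup⁺ x~N j , (λ eq → Nj∉ (here (sym eq))) ,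
                      (λ { (here refl) → x≁t (lookup⁺ x~N i) ; (there m) → Ni∉ m }) ,
                      (λ { (here refl) → x≁t (lookup⁺ x~N j) ; (there m) → Nj∉ (there m) })

    sees-P3-end : ∀ {w p q} → w ≢ x → p ≢ x → q ≢ x → w ~ p → w ~ q → p ≢ q → x ~ p
    sees-P3-end {w} {p} {q} w≢x p≢x q≢x wp wq p≢q with x ~? p
    ... | yes xp = xp
    ... | no x≁p with two-neighbours-outside w q x≁p
    ...   | n₁ , n₂ , xn₁ , xn₂ , n₁≢n₂ , n₁∉ , n₂∉ = ⊥-elim (disjoint-P3s
            ( (≢-sym (~⇒≢ xn₁) ∷ n₁≢n₂ ∷ ∉⇒≢ n₁∉ 0F ∷ ∉⇒≢ n₁∉ 1F ∷ ∉⇒≢ n₁∉ 2F ∷ [])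
            ∷ (~⇒≢ xn₂ ∷ ≢-sym p≢x ∷ ≢-sym w≢x ∷ ≢-sym q≢x ∷ [])
            ∷ (∉⇒≢ n₂∉ 0F ∷ ∉⇒≢ n₂∉ 1F ∷ ∉⇒≢ n₂∉ 2F ∷ [])
            ∷ (≢-sym (~⇒≢ wp) ∷ p≢q ∷ [])
            ∷ (~⇒≢ wq ∷ [])
            ∷ [] ∷ [])
            (~-sym xn₁) xn₂ (~-sym wp) wq)

    around-P3 : ∀ {w p q} → w ≢ x → p ≢ x → q ≢ x → w ~ p → w ~ q → p ≢ q → Conclusion G
    around-P3 {w} {p} {q} w≢x p≢x q≢x wp wq p≢q =
      conclude-K₅ S distinct (closed-by-contradiction escape) 2F (p , q , wp , wq , p≢q)
      where
      xp : x ~ p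
      xp = sees-P3-end w≢x p≢x q≢x wp wq p≢q
      xq : x ~ q
      xq = sees-P3-end w≢x q≢x p≢x wq wp (≢-sym p≢q)
      fourth = ∃-∉ (lookup N) N-injective (p ∷ w ∷ q ∷ []) (s≤s (s≤s (s≤s (s≤s z≤n))))
      r = lookup N (proj₁ fourth)
      xr : x ~ r
      xr = lookup⁺ x~N (proj₁ fourth)
      r∉ : r ∉ (p ∷ w ∷ q ∷ [])
      r∉ = proj₂ fourth
      S = x ∷ p ∷ w ∷ q ∷ r ∷ []
      distinct : Unique S
      distinct = (≢-sym p≢x ∷ ≢-sym w≢x ∷ ≢-sym q≢x ∷ ~⇒≢ xr ∷ [])
               ∷ (≢-sym (~⇒≢ wp) ∷ p≢q ∷ ≢-sym (∉⇒≢ r∉ 0F) ∷ [])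
               ∷ (~⇒≢ wq ∷ ≢-sym (∉⇒≢ r∉ 1F) ∷ [])
               ∷ (≢-sym (∉⇒≢ r∉ 2F) ∷ [])
               ∷ [] ∷ []
      escape : ∀ i {u} → lookup S i ~ u → u ∉ S → ⊥
      escape 0F e u∉ = disjoint-P3s-in (∉-∷ u∉ distinct) 0F 1F 5F 2F 3F 4F (~-sym e) xr (~-sym wp) wq
      escape 1F e u∉ = disjoint-P3s-in (∉-∷ u∉ distinct) 0F 2F 3F 4F 1F 5F (~-sym e) (~-sym wp) (~-sym xq) xr
      escape 2F e u∉ = disjoint-P3s-in (∉-∷ u∉ distinct) 0F 3F 2F 4F 1F 5F (~-sym e) wp (~-sym xq) xr
      escape 3F e u∉ = disjoint-P3s-in (∉-∷ u∉ distinct) 0F 4F 3F 2F 1F 5F (~-sym e) (~-sym wq) (~-sym xp) xr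
      escape 4F e u∉ = disjoint-P3s-in (∉-∷ u∉ distinct) 0F 5F 1F 2F 3F 4F (~-sym e) (~-sym xr) (~-sym wp) wq

    conclusion : Conclusion G
    conclusion with p3-avoiding? x
    ... | yes (w , p , q , w≢x , p≢x , q≢x , wp , wq , p≢q) = around-P3 w≢x p≢x q≢x wp wq p≢q
    ... | no none = conclude-F₂ x without-x
      where
      without-x : IsMatchingWithout G x
      without-x {w} {p} {q} w≢x p≢x q≢x wp wq with p ≟ q
      ... | yes p≡q = p≡q
      ... | no p≢q  = ⊥-elim (none (w , p , q , w≢x , p≢x , q≢x , wp , wq , p≢q))

  module MaxDegreeThree (Δ<4 : MaxDegree< 4) where

    record Claw (x a b c : Fin n) : Set where
      field
        x~a : x ~ a
        x~b : x ~ b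
        x~c : x ~ c
        a≢b : a ≢ b
        a≢c : a ≢ c
        b≢c : b ≢ c

    swap₁₂ : ∀ {x a b c} → Claw x a b c → Claw x b a c
    swap₁₂ claw = record { x~a = x~b ; x~b = x~a ; x~c = x~c ; a≢b = ≢-sym a≢b ; a≢c = b≢c ; b≢c = a≢c }
      where open Claw claw

    swap₂₃ : ∀ {x a b c} → Claw x a b c → Claw x a c b
    swap₂₃ claw = record { x~a = x~a ; x~b = x~c ; x~c = x~b ; a≢b = a≢c ; a≢c = a≢b ; b≢c = ≢-sym b≢c }
      where open Claw claw

    rotate : ∀ {x a b c} → Claw x a b c → Claw x c a b
    rotate claw = swap₁₂ (swap₂₃ claw)

    claw-neighbours : ∀ {x a b c u} → Claw x a b c → x ~ u → u ≢ a → u ≢ b → u ≢ c → ⊥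
    claw-neighbours claw xu u≢a u≢b u≢c =
      Δ<4 ((a≢b ∷ a≢c ∷ ≢-sym u≢a ∷ []) ∷ (b≢c ∷ ≢-sym u≢b ∷ []) ∷ (≢-sym u≢c ∷ []) ∷ [] ∷ []) (x~a ∷ x~b ∷ x~c ∷ xu ∷ [])
      where open Claw claw

    claw-neighbour : ∀ {x a b c u} → Claw x a b c → x ~ u → u ≡ a ⊎ u ≡ b ⊎ u ≡ c
    claw-neighbour {a = a} {b} {c} {u} claw xu with u ≟ a | u ≟ b | u ≟ c
    ... | yes u≡a | _       | _       = inj₁ u≡a
    ... | no _    | yes u≡b | _       = inj₂ (inj₁ u≡b)
    ... | no _    | no _    | yes u≡c = inj₂ (inj₂ u≡c)
    ... | no u≢a  | no u≢b  | no u≢c  = ⊥-elim (claw-neighbours claw xu u≢a u≢b u≢c)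

    -- For N(x) = {a, b, c}, being outside N[x] is stated without a, b, c, so that the
    -- notion is invariant under permuting the claw.
    Outer : Fin n → Fin n → Fin n → Set
    Outer x β u = β ~ u × u ≢ x × ¬ x ~ u

    OuterAtMost : Fin n → Fin n → Fin n → Set
    OuterAtMost x β t = ∀ {u} → Outer x β u → u ≡ t

    NoOuter : Fin n → Fin n → Set
    NoOuter x β = ∀ {u} → ¬ Outer x β u

    at-most-any : ∀ {x β} t → NoOuter x β → OuterAtMost x β t
    at-most-any t none o = ⊥-elim (none o)

    outer≢ : ∀ {x β t γ} → Outer x β t → x ~ γ → t ≢ γ
    outer≢ (_ , _ , x≁t) xγ refl = x≁t xγ

    outer-unique : ∀ {x a b c u t} → Claw x a b c → Outer x a u → Outer x a t → u ≡ t
    outer-unique {u = u} {t} claw ou@(au , u≢x , _) ot@(at , t≢x , _) with u ≟ t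
    ... | yes u≡t = u≡t
    ... | no u≢t  = ⊥-elim (disjoint-P3s
          ( (≢-sym (~⇒≢ au) ∷ u≢t ∷ outer≢ ou x~b ∷ u≢x ∷ outer≢ ou x~c ∷ [])
          ∷ (~⇒≢ at ∷ a≢b ∷ ≢-sym (~⇒≢ x~a) ∷ a≢c ∷ [])
          ∷ (outer≢ ot x~b ∷ t≢x ∷ outer≢ ot x~c ∷ [])
          ∷ (≢-sym (~⇒≢ x~b) ∷ b≢c ∷ [])
          ∷ (~⇒≢ x~c ∷ [])
          ∷ [] ∷ [])
          (~-sym au) at (~-sym x~b) x~c)
      where open Claw claw

    outer? : ∀ {x a b c} → Claw x a b c → NoOuter x a ⊎ ∃ λ t → Outer x a t × OuterAtMost x a t
    outer? {x} {a} claw with any? (λ u → (a ~? u) ×-dec ¬? (u ≟ x) ×-dec ¬? (x ~? u))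
    ... | yes (t , ot) = inj₂ (t , ot , λ ou → outer-unique claw ou ot)
    ... | no none      = inj₁ λ {u} ou → none (u , ou)

    beyond-outer : ∀ {x a b c t u} → Claw x a b c → Outer x a t → t ~ u → u ≢ x → u ≢ a → u ≢ b → u ≢ c → ⊥
    beyond-outer claw ot@(at , t≢x , _) tu u≢x u≢a u≢b u≢c = disjoint-P3s
      ( (≢-sym (~⇒≢ tu) ∷ u≢a ∷ u≢b ∷ u≢x ∷ u≢c ∷ [])
      ∷ (outer≢ ot x~a ∷ outer≢ ot x~b ∷ t≢x ∷ outer≢ ot x~c ∷ [])
      ∷ (a≢b ∷ ≢-sym (~⇒≢ x~a) ∷ a≢c ∷ [])
      ∷ (≢-sym (~⇒≢ x~b) ∷ b≢c ∷ [])
      ∷ (~⇒≢ x~c ∷ [])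
      ∷ [] ∷ [])
      (~-sym tu) (~-sym at) (~-sym x~b) x~c
      where open Claw claw

    claw-∉ : ∀ {x a b c k u} {R : Vec (Fin n) k} → Claw x a b c → u ∉ (x ∷ a ∷ b ∷ c ∷ R) → ¬ x ~ u
    claw-∉ claw u∉ xu = claw-neighbours claw xu (∉⇒≢ u∉ 1F) (∉⇒≢ u∉ 2F) (∉⇒≢ u∉ 3F)

    outer-∉ : ∀ {x a b c k u} {R : Vec (Fin n) k} → Claw x a b c → u ∉ (x ∷ a ∷ b ∷ c ∷ R) →
      ∀ {β} → β ~ u → Outer x β u
    outer-∉ claw u∉ βu = βu , ∉⇒≢ u∉ 0F , claw-∉ claw u∉

    beyond-outer-∉ : ∀ {x a b c t k u} {R : Vec (Fin n) k} → Claw x a b c → Outer x a t → t ~ u →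
      u ∉ (x ∷ a ∷ b ∷ c ∷ R) → ⊥
    beyond-outer-∉ claw oa tu u∉ = beyond-outer claw oa tu (∉⇒≢ u∉ 0F) (∉⇒≢ u∉ 1F) (∉⇒≢ u∉ 2F) (∉⇒≢ u∉ 3F)

    shared-outer : ∀ {x a b c t t′} → Claw x a b c → Outer x a t → Outer x b t → Outer x c t′ → t ≢ t′ → ⊥
    shared-outer claw oa@(at , t≢x , _) ob oc@(ct′ , t′≢x , _) t≢t′ = disjoint-P3s
      ( (≢-sym (outer≢ oa x~a) ∷ a≢b ∷ ≢-sym (~⇒≢ x~a) ∷ a≢c ∷ ≢-sym (outer≢ oc x~a) ∷ [])
      ∷ (outer≢ oa x~b ∷ t≢x ∷ outer≢ oa x~c ∷ t≢t′ ∷ [])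
      ∷ (≢-sym (~⇒≢ x~b) ∷ b≢c ∷ ≢-sym (outer≢ oc x~b) ∷ [])
      ∷ (~⇒≢ x~c ∷ ≢-sym t′≢x ∷ [])
      ∷ (~⇒≢ ct′ ∷ [])
      ∷ [] ∷ [])
      at (~-sym (proj₁ ob)) x~c ct′
      where open Claw claw

    distinct-outers⇒≁ : ∀ {x a b c ta tb} → Claw x a b c → Outer x a ta → Outer x b tb → ta ≢ tb → ¬ a ~ c
    distinct-outers⇒≁ claw oa@(ata , ta≢x , _) ob@(btb , tb≢x , _) ta≢tb ac = disjoint-P3s
      ( (outer≢ oa x~a ∷ outer≢ oa x~c ∷ ta≢x ∷ outer≢ oa x~b ∷ ta≢tb ∷ [])
      ∷ (a≢c ∷ ≢-sym (~⇒≢ x~a) ∷ a≢b ∷ ≢-sym (outer≢ ob x~a) ∷ [])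
      ∷ (≢-sym (~⇒≢ x~c) ∷ ≢-sym b≢c ∷ ≢-sym (outer≢ ob x~c) ∷ [])
      ∷ (~⇒≢ x~b ∷ ≢-sym tb≢x ∷ [])
      ∷ (~⇒≢ btb ∷ [])
      ∷ [] ∷ [])
      (~-sym ata) ac x~b btb
      where open Claw claw

    outers-nonadjacent : ∀ {x a b c ta tb} → Claw x a b c → Outer x a ta → Outer x b tb → ¬ ta ~ tb
    outers-nonadjacent claw oa@(ata , ta≢x , _) ob@(btb , tb≢x , _) tatb = disjoint-P3s
      ( (≢-sym (outer≢ oa x~a) ∷ ≢-sym (outer≢ ob x~a) ∷ a≢b ∷ ≢-sym (~⇒≢ x~a) ∷ a≢c ∷ [])
      ∷ (~⇒≢ tatb ∷ outer≢ oa x~b ∷ ta≢x ∷ outer≢ oa x~c ∷ [])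
      ∷ (outer≢ ob x~b ∷ tb≢x ∷ outer≢ ob x~c ∷ [])
      ∷ (≢-sym (~⇒≢ x~b) ∷ b≢c ∷ [])
      ∷ (~⇒≢ x~c ∷ [])
      ∷ [] ∷ [])
      ata tatb (~-sym x~b) x~c
      where open Claw claw

    inner-pendant : ∀ {x a b c ta tb tc p} → Claw x a b c → Outer x a ta → OuterAtMost x a ta →
      Outer x b tb → Outer x c tc → ta ≢ tb → ta ≢ tc → a ~ p → p ≢ x → p ≡ ta
    inner-pendant {x = x} {p = p} claw oa at-most ob oc ta≢tb ta≢tc ap p≢x with x ~? p
    ... | no x≁p = at-most (ap , p≢x , x≁p)
    ... | yes xp with claw-neighbour claw xp
    ...   | inj₁ refl        = ⊥-elim (~⇒≢ ap refl)
    ...   | inj₂ (inj₁ refl) = ⊥-elim (distinct-outers⇒≁ (swap₂₃ claw) oa oc ta≢tc ap)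
    ...   | inj₂ (inj₂ refl) = ⊥-elim (distinct-outers⇒≁ claw oa ob ta≢tb ap)

    outer-pendant : ∀ {x a b c ta tb tc p} → Claw x a b c → Outer x a ta →
      OuterAtMost x b tb → OuterAtMost x c tc → ta ≢ tb → ta ≢ tc → ta ~ p → p ≢ x → p ≡ a
    outer-pendant {x = x} {a} {p = p} claw oa@(ata , ta≢x , x≁ta) b-at-most c-at-most ta≢tb ta≢tc tap p≢x
      with p ≟ a
    ... | yes p≡a = p≡a
    ... | no p≢a with x ~? p
    ...   | no x≁p = ⊥-elim (beyond-outer claw oa tap p≢x p≢a (λ { refl → x≁p x~b }) (λ { refl → x≁p x~c }))
      where open Claw claw
    ...   | yes xp with claw-neighbour claw xp
    ...     | inj₁ p≡a         = ⊥-elim (p≢a p≡a)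
    ...     | inj₂ (inj₁ refl) = ⊥-elim (ta≢tb (b-at-most (~-sym tap , ta≢x , x≁ta)))
    ...     | inj₂ (inj₂ refl) = ⊥-elim (ta≢tc (c-at-most (~-sym tap , ta≢x , x≁ta)))

    claw-K₄ : ∀ {x a b c} → Claw x a b c → NoOuter x a → NoOuter x b → NoOuter x c → Conclusion G
    claw-K₄ {x} {a} {b} {c} claw a-none b-none c-none =
      conclude-K₄ S distinct (closed-by-contradiction escape) 0F (a , b , x~a , x~b , a≢b)
      where
      open Claw claw
      S = x ∷ a ∷ b ∷ c ∷ []
      distinct : Unique S
      distinct = (~⇒≢ x~a ∷ ~⇒≢ x~b ∷ ~⇒≢ x~c ∷ []) ∷ (a≢b ∷ a≢c ∷ []) ∷ (b≢c ∷ []) ∷ [] ∷ []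
      escape : ∀ i {u} → lookup S i ~ u → u ∉ S → ⊥
      escape 0F e u∉ = claw-∉ claw u∉ e
      escape 1F e u∉ = a-none (outer-∉ claw u∉ e)
      escape 2F e u∉ = b-none (outer-∉ claw u∉ e)
      escape 3F e u∉ = c-none (outer-∉ claw u∉ e)

    claw-K₅ : ∀ {x a b c t} → Claw x a b c → Outer x a t →
      OuterAtMost x a t → OuterAtMost x b t → OuterAtMost x c t → Conclusion G
    claw-K₅ {x} {a} {b} {c} {t} claw oa@(_ , t≢x , _) a-at-most b-at-most c-at-most =
      conclude-K₅ S distinct (closed-by-contradiction escape) 0F (a , b , x~a , x~b , a≢b)
      where
      open Claw claw
      S = x ∷ a ∷ b ∷ c ∷ t ∷ []
      distinct : Unique S
      distinct = (~⇒≢ x~a ∷ ~⇒≢ x~b ∷ ~⇒≢ x~c ∷ ≢-sym t≢x ∷ [])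
               ∷ (a≢b ∷ a≢c ∷ ≢-sym (outer≢ oa x~a) ∷ [])
               ∷ (b≢c ∷ ≢-sym (outer≢ oa x~b) ∷ [])
               ∷ (≢-sym (outer≢ oa x~c) ∷ [])
               ∷ [] ∷ []
      escape : ∀ i {u} → lookup S i ~ u → u ∉ S → ⊥
      escape 0F e u∉ = claw-∉ claw u∉ e
      escape 1F e u∉ = ∉⇒≢ u∉ 4F (a-at-most (outer-∉ claw u∉ e))
      escape 2F e u∉ = ∉⇒≢ u∉ 4F (b-at-most (outer-∉ claw u∉ e))
      escape 3F e u∉ = ∉⇒≢ u∉ 4F (c-at-most (outer-∉ claw u∉ e))
      escape 4F e u∉ = beyond-outer-∉ claw oa e u∉

    claw-N₆-edges : ∀ {x a b c ta tb} → Claw x a b c → Outer x a ta → OuterAtMost x a ta →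
      Outer x b tb → OuterAtMost x b tb → ta ≢ tb → NoOuter x c →
      ∀ i j → lookup (x ∷ a ∷ b ∷ c ∷ ta ∷ tb ∷ []) i ~ lookup (x ∷ a ∷ b ∷ c ∷ ta ∷ tb ∷ []) j → N6 i j ≡ true
    claw-N₆-edges {x} {a} {b} {c} {ta} {tb} claw oa@(_ , ta≢x , x≁ta) a-at-most ob@(_ , tb≢x , x≁tb) b-at-most ta≢tb c-none =
      edges
      where
      a≁c : ¬ a ~ c
      a≁c = distinct-outers⇒≁ claw oa ob ta≢tb
      b≁c : ¬ b ~ c
      b≁c = distinct-outers⇒≁ (swap₁₂ claw) ob oa (≢-sym ta≢tb)
      a≁tb : ¬ a ~ tb
      a≁tb atb = ta≢tb (sym (a-at-most (atb , tb≢x , x≁tb)))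
      b≁ta : ¬ b ~ ta
      b≁ta bta = ta≢tb (b-at-most (bta , ta≢x , x≁ta))
      c≁ta : ¬ c ~ ta
      c≁ta cta = c-none (cta , ta≢x , x≁ta)
      c≁tb : ¬ c ~ tb
      c≁tb ctb = c-none (ctb , tb≢x , x≁tb)
      ta≁tb : ¬ ta ~ tb
      ta≁tb = outers-nonadjacent claw oa ob
      edges : ∀ i j → lookup (x ∷ a ∷ b ∷ c ∷ ta ∷ tb ∷ []) i ~ lookup (x ∷ a ∷ b ∷ c ∷ ta ∷ tb ∷ []) j → N6 i j ≡ true
      edges 0F 0F e = ⊥-elim (~⇒≢ e refl)
      edges 0F 1F e = refl
      edges 0F 2F e = refl
      edges 0F 3F e = refl
      edges 0F 4F e = ⊥-elim (x≁ta e)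
      edges 0F 5F e = ⊥-elim (x≁tb e)
      edges 1F 0F e = refl
      edges 1F 1F e = ⊥-elim (~⇒≢ e refl)
      edges 1F 2F e = refl
      edges 1F 3F e = ⊥-elim (a≁c e)
      edges 1F 4F e = refl
      edges 1F 5F e = ⊥-elim (a≁tb e)
      edges 2F 0F e = refl
      edges 2F 1F e = refl
      edges 2F 2F e = ⊥-elim (~⇒≢ e refl)
      edges 2F 3F e = ⊥-elim (b≁c e)
      edges 2F 4F e = ⊥-elim (b≁ta e)
      edges 2F 5F e = refl
      edges 3F 0F e = refl
      edges 3F 1F e = ⊥-elim (a≁c (~-sym e))
      edges 3F 2F e = ⊥-elim (b≁c (~-sym e))
      edges 3F 3F e = ⊥-elim (~⇒≢ e refl)
      edges 3F 4F e = ⊥-elim (c≁ta e)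
      edges 3F 5F e = ⊥-elim (c≁tb e)
      edges 4F 0F e = ⊥-elim (x≁ta (~-sym e))
      edges 4F 1F e = refl
      edges 4F 2F e = ⊥-elim (b≁ta (~-sym e))
      edges 4F 3F e = ⊥-elim (c≁ta (~-sym e))
      edges 4F 4F e = ⊥-elim (~⇒≢ e refl)
      edges 4F 5F e = ⊥-elim (ta≁tb e)
      edges 5F 0F e = ⊥-elim (x≁tb (~-sym e))
      edges 5F 1F e = ⊥-elim (a≁tb (~-sym e))
      edges 5F 2F e = refl
      edges 5F 3F e = ⊥-elim (c≁tb (~-sym e))
      edges 5F 4F e = ⊥-elim (ta≁tb (~-sym e))
      edges 5F 5F e = ⊥-elim (~⇒≢ e refl)


    claw-N₆ : ∀ {x a b c ta tb} → Claw x a b c → Outer x a ta → OuterAtMost x a ta →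
      Outer x b tb → OuterAtMost x b tb → ta ≢ tb → NoOuter x c → Conclusion G
    claw-N₆ {x} {a} {b} {c} {ta} {tb} claw oa@(ata , ta≢x , x≁ta) a-at-most ob@(btb , tb≢x , x≁tb) b-at-most ta≢tb c-none =
      conclude-N₆ S distinct (closed-by-contradiction escape) (claw-N₆-edges claw oa a-at-most ob b-at-most ta≢tb c-none) 0F (a , b , x~a , x~b , a≢b)
      where
      open Claw claw
      S = x ∷ a ∷ b ∷ c ∷ ta ∷ tb ∷ []
      distinct : Unique S
      distinct = (~⇒≢ x~a ∷ ~⇒≢ x~b ∷ ~⇒≢ x~c ∷ ≢-sym ta≢x ∷ ≢-sym tb≢x ∷ [])
               ∷ (a≢b ∷ a≢c ∷ ~⇒≢ ata ∷ ≢-sym (outer≢ ob x~a) ∷ [])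
               ∷ (b≢c ∷ ≢-sym (outer≢ oa x~b) ∷ ~⇒≢ btb ∷ [])
               ∷ (≢-sym (outer≢ oa x~c) ∷ ≢-sym (outer≢ ob x~c) ∷ [])
               ∷ (ta≢tb ∷ [])
               ∷ [] ∷ []
      escape : ∀ i {u} → lookup S i ~ u → u ∉ S → ⊥
      escape 0F e u∉ = claw-∉ claw u∉ e
      escape 1F e u∉ = ∉⇒≢ u∉ 4F (a-at-most (outer-∉ claw u∉ e))
      escape 2F e u∉ = ∉⇒≢ u∉ 5F (b-at-most (outer-∉ claw u∉ e))
      escape 3F e u∉ = c-none (outer-∉ claw u∉ e)
      escape 4F e u∉ = beyond-outer-∉ claw oa e u∉
      escape 5F e u∉ = beyond-outer (swap₁₂ claw) ob e (∉⇒≢ u∉ 0F) (∉⇒≢ u∉ 2F) (∉⇒≢ u∉ 1F) (∉⇒≢ u∉ 3F)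

    claw-F₂ : ∀ {x a b c ta tb tc} → Claw x a b c →
      Outer x a ta → OuterAtMost x a ta → Outer x b tb → OuterAtMost x b tb → Outer x c tc → OuterAtMost x c tc →
      ta ≢ tb → ta ≢ tc → tb ≢ tc → Conclusion G
    claw-F₂ {x} {a} {b} {c} {ta} {tb} {tc} claw oa@(ata , ta≢x , _) a-at-most ob@(btb , tb≢x , _) b-at-most
      oc@(ctc , tc≢x , _) c-at-most ta≢tb ta≢tc tb≢tc =
      conclude-F₂ x (matching-without (closed-by-contradiction escape) 0F (a , b , x~a , x~b , a≢b) x inside)
      where
      open Claw claw
      S = x ∷ a ∷ b ∷ c ∷ ta ∷ tb ∷ tc ∷ []
      a-pendant : ∀ {p} → a ~ p → p ≢ x → p ≡ ta
      a-pendant = inner-pendant claw oa a-at-most ob oc ta≢tb ta≢tc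
      b-pendant : ∀ {p} → b ~ p → p ≢ x → p ≡ tb
      b-pendant = inner-pendant (swap₁₂ claw) ob b-at-most oa oc (≢-sym ta≢tb) tb≢tc
      c-pendant : ∀ {p} → c ~ p → p ≢ x → p ≡ tc
      c-pendant = inner-pendant (rotate claw) oc c-at-most oa ob (≢-sym ta≢tc) (≢-sym tb≢tc)
      ta-pendant : ∀ {p} → ta ~ p → p ≢ x → p ≡ a
      ta-pendant = outer-pendant claw oa b-at-most c-at-most ta≢tb ta≢tc
      tb-pendant : ∀ {p} → tb ~ p → p ≢ x → p ≡ b
      tb-pendant = outer-pendant (swap₁₂ claw) ob a-at-most c-at-most (≢-sym ta≢tb) tb≢tc
      tc-pendant : ∀ {p} → tc ~ p → p ≢ x → p ≡ c
      tc-pendant = outer-pendant (rotate claw) oc a-at-most b-at-most (≢-sym ta≢tc) (≢-sym tb≢tc)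
      escape : ∀ i {u} → lookup S i ~ u → u ∉ S → ⊥
      escape 0F e u∉ = claw-∉ claw u∉ e
      escape 1F e u∉ = ∉⇒≢ u∉ 4F (a-pendant e (∉⇒≢ u∉ 0F))
      escape 2F e u∉ = ∉⇒≢ u∉ 5F (b-pendant e (∉⇒≢ u∉ 0F))
      escape 3F e u∉ = ∉⇒≢ u∉ 6F (c-pendant e (∉⇒≢ u∉ 0F))
      escape 4F e u∉ = ∉⇒≢ u∉ 1F (ta-pendant e (∉⇒≢ u∉ 0F))
      escape 5F e u∉ = ∉⇒≢ u∉ 2F (tb-pendant e (∉⇒≢ u∉ 0F))
      escape 6F e u∉ = ∉⇒≢ u∉ 3F (tc-pendant e (∉⇒≢ u∉ 0F))
      inside : ∀ j {p q} → lookup S j ≢ x → lookup S j ~ p → lookup S j ~ q → p ≢ x → q ≢ x → p ≡ q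
      inside 0F x≢x _ _ _ _ = ⊥-elim (x≢x refl)
      inside 1F _ e₁ e₂ p≢x q≢x = trans (a-pendant e₁ p≢x) (sym (a-pendant e₂ q≢x))
      inside 2F _ e₁ e₂ p≢x q≢x = trans (b-pendant e₁ p≢x) (sym (b-pendant e₂ q≢x))
      inside 3F _ e₁ e₂ p≢x q≢x = trans (c-pendant e₁ p≢x) (sym (c-pendant e₂ q≢x))
      inside 4F _ e₁ e₂ p≢x q≢x = trans (ta-pendant e₁ p≢x) (sym (ta-pendant e₂ q≢x))
      inside 5F _ e₁ e₂ p≢x q≢x = trans (tb-pendant e₁ p≢x) (sym (tb-pendant e₂ q≢x))
      inside 6F _ e₁ e₂ p≢x q≢x = trans (tc-pendant e₁ p≢x) (sym (tc-pendant e₂ q≢x))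

    conclusion : ∀ {x a b c} → Claw x a b c → Conclusion G
    conclusion claw with outer? claw | outer? (swap₁₂ claw) | outer? (rotate claw)
    ... | inj₁ a-none | inj₁ b-none | inj₁ c-none = claw-K₄ claw a-none b-none c-none
    ... | inj₂ (ta , oa , a≤) | inj₁ b-none | inj₁ c-none =
          claw-K₅ claw oa a≤ (at-most-any ta b-none) (at-most-any ta c-none)
    ... | inj₁ a-none | inj₂ (tb , ob , b≤) | inj₁ c-none =
          claw-K₅ (swap₁₂ claw) ob b≤ (at-most-any tb a-none) (at-most-any tb c-none)
    ... | inj₁ a-none | inj₁ b-none | inj₂ (tc , oc , c≤) =
          claw-K₅ (rotate claw) oc c≤ (at-most-any tc a-none) (at-most-any tc b-none)
    ... | inj₂ (ta , oa , a≤) | inj₂ (tb , ob , b≤) | inj₁ c-none with ta ≟ tb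
    ...   | yes refl  = claw-K₅ claw oa a≤ b≤ (at-most-any ta c-none)
    ...   | no ta≢tb = claw-N₆ claw oa a≤ ob b≤ ta≢tb c-none
    conclusion claw | inj₂ (ta , oa , a≤) | inj₁ b-none | inj₂ (tc , oc , c≤) with ta ≟ tc
    ...   | yes refl  = claw-K₅ claw oa a≤ (at-most-any ta b-none) c≤
    ...   | no ta≢tc = claw-N₆ (swap₂₃ claw) oa a≤ oc c≤ ta≢tc b-none
    conclusion claw | inj₁ a-none | inj₂ (tb , ob , b≤) | inj₂ (tc , oc , c≤) with tb ≟ tc
    ...   | yes refl  = claw-K₅ (swap₁₂ claw) ob b≤ (at-most-any tb a-none) c≤
    ...   | no tb≢tc = claw-N₆ (rotate (rotate claw)) ob b≤ oc c≤ tb≢tc a-none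
    conclusion claw | inj₂ (ta , oa , a≤) | inj₂ (tb , ob , b≤) | inj₂ (tc , oc , c≤) with ta ≟ tb | ta ≟ tc | tb ≟ tc
    ...   | yes refl | yes refl | _        = claw-K₅ claw oa a≤ b≤ c≤
    ...   | yes refl | no ta≢tc | _        = ⊥-elim (shared-outer claw oa ob oc ta≢tc)
    ...   | no ta≢tb | yes refl | _        = ⊥-elim (shared-outer (swap₂₃ claw) oa oc ob ta≢tb)
    ...   | no ta≢tb | no ta≢tc | yes refl = ⊥-elim (shared-outer (rotate (rotate claw)) ob oc oa (≢-sym ta≢tb))
    ...   | no ta≢tb | no ta≢tc | no tb≢tc = claw-F₂ claw oa a≤ ob b≤ oc c≤ ta≢tb ta≢tc tb≢tc

  classify : Fin n → Conclusion G
  classify v with maxDegree<-or-witness 4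
  ... | inj₂ (x , N , distinct , x~N) = FourNeighbours.conclusion N distinct x~N
  ... | inj₁ Δ<4 with maxDegree<-or-witness 3
  ...   | inj₂ (x , a ∷ b ∷ c ∷ [] , ((a≢b ∷ a≢c ∷ []) ∷ (b≢c ∷ []) ∷ [] ∷ []) , (x~a ∷ x~b ∷ x~c ∷ [])) =
          MaxDegreeThree.conclusion Δ<4 (record { x~a = x~a ; x~b = x~b ; x~c = x~c ; a≢b = a≢b ; a≢c = a≢c ; b≢c = b≢c })
  ...   | inj₁ Δ<3 with maxDegree<-or-witness 2
  ...     | inj₂ (x , y ∷ z ∷ [] , ((y≢z ∷ []) ∷ [] ∷ []) , (x~y ∷ x~z ∷ [])) = MaxDegreeTwo.conclusion Δ<3 x~y x~z y≢z
  ...     | inj₁ Δ<2 = conclude-F₂ v λ _ _ _ wp wq → Δ≤1 wp wq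
    where
    Δ≤1 : ∀ {w p q} → w ~ p → w ~ q → p ≡ q
    Δ≤1 {p = p} {q} wp wq with p ≟ q
    ... | yes p≡q = p≡q
    ... | no p≢q  = ⊥-elim (Δ<2 ((p≢q ∷ []) ∷ [] ∷ []) (wp ∷ wq ∷ []))

lemma3p1 : (n : ℕ) (G : Graph n) → IsSimple G → 6 ≤ n → ¬ (TwoP3 ⊆ G) →
    (Σ ℕ λ h → 4 ≤ h × h ≤ 5 × G ⊆ F n 1 (K h))
    ⊎ (G ⊆ F n 1 N6)
    ⊎ (G ⊆ F n 2 (K 2))
lemma3p1 (suc n) G simple (s≤s _) free = FreeOf2P3.classify simple free 0F
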